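{- (a) $F^4+FG+G^4=0$. (b) $D^3=G$.
   Context: In $\mathbb{Z}/2[[x]]$: $F=\sum_{n>0,\ n\text{ odd}}x^{n^2}$, $G=F(x^3)$, and $D=\sum_{n>0,\ \gcd(n,6)=1}x^{n^2}$. -}

module Defs where

open import Data.Bool using (Bool; true; false; _∧_; _xor_; if_then_else_)
open import Data.Nat using (ℕ; zero; suc; _+_; _*_; _∸_; _≡ᵇ_; _%_; _/_)
open import Data.Nat.GCD using (gcd)
open import Data.List using (List; map; foldr; upTo)
open import Data.Bool.ListAction using (any)

-- Formal power series over ℤ/2 : coefficient functions ℕ → Bool
-- (true = 1, false = 0 in 𝔽₂).
PS : Set
PS = ℕ → Bool

_⊕_ : PS → PS → PS
(f ⊕ g) n = f n xor g n
infixl 6 _⊕_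

_⊛_ : PS → PS → PS
(f ⊛ g) n = foldr _xor_ false (map (λ k → f k ∧ g (n ∸ k)) (upTo (suc n)))
infixl 7 _⊛_

one : PS
one zero    = true
one (suc _) = false

zeroPS : PS
zeroPS _ = false

_^ₚ_ : PS → ℕ → PS
f ^ₚ zero  = one
f ^ₚ suc m = f ⊛ (f ^ₚ m)
infixr 8 _^ₚ_

sub3 : PS → PS
sub3 f n = if n % 3 ≡ᵇ 0 then f (n / 3) else false

-- F = Σ_{n>0, n odd} x^{n²}: coefficient of x^m is 1 iff m = k² for some odd k
-- (such k satisfies k ≤ m, and odd k is automatically > 0; the k are distinct
-- so each m = k² gets coefficient exactly 1).
F : PS
F m = any (λ k → (k % 2 ≡ᵇ 1) ∧ (k * k ≡ᵇ m)) (upTo (suc m))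

G : PS
G = sub3 F

D : PS
D m = any (λ k → (gcd k 6 ≡ᵇ 1) ∧ (k * k ≡ᵇ m)) (upTo (suc m))

{-# OPTIONS --safe #-}
module Submission where

-- Write θ T = Σ_{x ≥ 0} q^{T(2x+1)²}, so that F = θ 1, G = θ 3 and, since the n prime to 6
-- are the odd n that are not odd multiples of 3, D = θ 1 + θ 9.  Over 𝔽₂ squaring is the
-- Frobenius f(q) ↦ f(q²), so (θ T)⁴ = θ (4T).  The key identity is θ T · θ (3T) = θ (4T) + θ (12T):
-- the coefficient of q^m on the left is the parity of the number of pairs (a, b) of positive odd
-- numbers with T(a² + 3b²) = m, and multiplying a + b√−3 by a primitive sixth root of unity and
-- taking absolute values is an involution on these pairs whose fixed points are exactly a = b and
-- a = 3b, which contribute θ (4T) and θ (12T).  Then F⁴ + FG + G⁴ = θ 4 + (θ 4 + θ 12) + θ 12 = 0,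
-- and D⁴ = θ 4 + θ 36 = (θ 1 + θ 9) θ 3 = DG, so D(D³ + G) = 0, where D = q + O(q²) can be cancelled.

open import Defs
open import Algebra.Bundles using (CommutativeRing)
open import Data.Bool using (Bool; true; false; _∧_; _∨_; _xor_; not; T)
open import Data.Bool.ListAction using (any)
open import Data.Bool.Properties
  using ( xor-assoc; xor-comm; xor-identityʳ; xor-same; xor-inverseˡ; xor-∧-commutativeRing
        ; ∧-assoc; ∧-comm; ∧-idem; ∧-zeroʳ; ∧-identityʳ; ∧-distribˡ-xor; ∧-distribʳ-xor )
open import Data.Empty using (⊥-elim)
open import Data.List using (_∷_; []; map; foldr; upTo; applyUpTo)
open import Data.List.Properties using (map-upTo)
open import Data.Nat
  using ( ℕ; zero; suc; _+_; _*_; _∸_; _/_; _%_; _≡ᵇ_; _≤ᵇ_; _<_; _≤_; s≤s; z≤n; z<s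
        ; _≟_; _≤?_; _<?_; NonZero; parity; ⌊_/2⌋; ∣_-_∣ )
open import Data.Nat.DivMod
open import Data.Nat.Divisibility using (divides)
open import Data.Nat.GCD using (gcd; GCD; module GCD; gcd-GCD)
open import Data.Nat.Induction using (<-rec)
open import Data.Nat.Properties
open import Data.Nat.Tactic.RingSolver using (solve-∀; solve)
open import Data.Parity.Base using (Parity; 0ℙ; 1ℙ)
open import Data.Product using (_×_; _,_; proj₁; proj₂; ∃-syntax)
open import Data.Product.Properties using (≡-dec; ,-injectiveˡ; ,-injectiveʳ)
open import Data.Sum using (_⊎_; inj₁; inj₂; [_,_]′)
open import Data.Unit using (tt)
open import Function using (_∘_; case_of_)
open import Relation.Binary.Definitions using (DecidableEquality; tri<; tri≈; tri>)
open import Relation.Binary.PropositionalEquality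
open import Relation.Nullary using (does; yes; no)
open import Relation.Nullary.Decidable using (dec-true; dec-false)
open import Algebra.Properties.CommutativeSemigroup
  (CommutativeRing.+-commutativeSemigroup xor-∧-commutativeRing) using () renaming (interchange to xor-interchange)

≡ᵇ-refl : ∀ n → (n ≡ᵇ n) ≡ true
≡ᵇ-refl n = dec-true (n ≟ n) refl

≢⇒≡ᵇ-false : ∀ {m n} → m ≢ n → (m ≡ᵇ n) ≡ false
≢⇒≡ᵇ-false {m} {n} = dec-false (m ≟ n)

≡ᵇ-true⇒≡ : ∀ {m n} → (m ≡ᵇ n) ≡ true → m ≡ n
≡ᵇ-true⇒≡ {m} {n} eq = ≡ᵇ⇒≡ m n (subst T (sym eq) tt)

≡ᵇ-false⇒≢ : ∀ {m n} → (m ≡ᵇ n) ≡ false → m ≢ n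
≡ᵇ-false⇒≢ {m} eq refl = case trans (sym eq) (≡ᵇ-refl m) of λ ()

∧-true : ∀ {a b} → a ∧ b ≡ true → a ≡ true × b ≡ true
∧-true {true} {true} _ = refl , refl

∧-not-true : ∀ {a b} → a ∧ not b ≡ true → a ≡ true × b ≡ false
∧-not-true {true} {false} _ = refl , refl

xor-cancelˡ : ∀ a b → a xor (a xor b) ≡ b
xor-cancelˡ a b = trans (sym (xor-assoc a a b)) (cong (_xor b) (xor-same a))

xor≡false⇒≡ : ∀ {a b} → a xor b ≡ false → a ≡ b
xor≡false⇒≡ {a} {b} eq = trans (sym (xor-identityʳ a)) (trans (cong (a xor_) (sym eq)) (xor-cancelˡ a b))

xorSum : (ℕ → Bool) → ℕ → Bool
xorSum g zero    = false
xorSum g (suc n) = xorSum g n xor g n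

syntax xorSum (λ k → e) n = ⨁[ k < n ] e

module _ {g h : ℕ → Bool} where

  xorSum-cong : ∀ n → (∀ k → k < n → g k ≡ h k) → xorSum g n ≡ xorSum h n
  xorSum-cong zero    _  = refl
  xorSum-cong (suc n) eq =
    cong₂ _xor_ (xorSum-cong n (λ k k<n → eq k (m<n⇒m<1+n k<n))) (eq n (n<1+n n))

  xorSum-ext : ∀ n → (∀ k → g k ≡ h k) → xorSum g n ≡ xorSum h n
  xorSum-ext n eq = xorSum-cong n (λ k _ → eq k)

  xorSum-xor : ∀ n → (⨁[ k < n ] (g k xor h k)) ≡ xorSum g n xor xorSum h n
  xorSum-xor zero    = refl
  xorSum-xor (suc n) = trans (cong (_xor (g n xor h n)) (xorSum-xor n)) (xor-interchange (xorSum g n) (xorSum h n) (g n) (h n))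

∧-distribˡ-xorSum : ∀ b g n → b ∧ xorSum g n ≡ ⨁[ k < n ] (b ∧ g k)
∧-distribˡ-xorSum b g zero    = ∧-zeroʳ b
∧-distribˡ-xorSum b g (suc n) =
  trans (∧-distribˡ-xor b (xorSum g n) (g n)) (cong (_xor (b ∧ g n)) (∧-distribˡ-xorSum b g n))

∧-distribʳ-xorSum : ∀ b g n → xorSum g n ∧ b ≡ ⨁[ k < n ] (g k ∧ b)
∧-distribʳ-xorSum b g zero    = refl
∧-distribʳ-xorSum b g (suc n) =
  trans (∧-distribʳ-xor b (xorSum g n) (g n)) (cong (_xor (g n ∧ b)) (∧-distribʳ-xorSum b g n))

xorSum-false : ∀ g n → (∀ k → k < n → g k ≡ false) → xorSum g n ≡ false
xorSum-false g zero    _    = refl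
xorSum-false g (suc n) g≡f =
  cong₂ _xor_ (xorSum-false g n (λ k k<n → g≡f k (m<n⇒m<1+n k<n))) (g≡f n (n<1+n n))

xorSum-single : ∀ g n j → j < n → (∀ k → k < n → k ≢ j → g k ≡ false) → xorSum g n ≡ g j
xorSum-single g (suc n) j j<1+n g≡f with j ≟ n
... | yes refl = cong (_xor g j) (xorSum-false g n (λ k k<n → g≡f k (m<n⇒m<1+n k<n) (<⇒≢ k<n)))
... | no j≢n   = begin
  xorSum g n xor g n ≡⟨ cong₂ _xor_ (xorSum-single g n j j<n (λ k k<n → g≡f k (m<n⇒m<1+n k<n)))
                                   (g≡f n (n<1+n n) (j≢n ∘ sym)) ⟩
  g j xor false      ≡⟨ xor-identityʳ (g j) ⟩
  g j                ∎
  where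
  open ≡-Reasoning
  j<n : j < n
  j<n = ≤∧≢⇒< (≤-pred j<1+n) j≢n

xorSum-single′ : ∀ g n j → (∀ k → k < n → k ≢ j → g k ≡ false) → (n ≤ j → g j ≡ false) → xorSum g n ≡ g j
xorSum-single′ g n j g≡f outside with j <? n
... | yes j<n = xorSum-single g n j j<n g≡f
... | no  j≮n = trans (xorSum-false g n (λ k k<n → g≡f k k<n (λ { refl → j≮n k<n }))) (sym (outside (≮⇒≥ j≮n)))

xorSum-select : ∀ (b : ℕ → Bool) a N → (N ≤ a → b a ≡ false) → (⨁[ k < N ] (b k ∧ (k ≡ᵇ a))) ≡ b a
xorSum-select b a N outside = begin
  (⨁[ k < N ] (b k ∧ (k ≡ᵇ a))) ≡⟨ xorSum-single′ _ N a off-a (λ N≤a → cong (_∧ (a ≡ᵇ a)) (outside N≤a)) ⟩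
  b a ∧ (a ≡ᵇ a)                ≡⟨ cong (b a ∧_) (≡ᵇ-refl a) ⟩
  b a ∧ true                    ≡⟨ ∧-identityʳ (b a) ⟩
  b a                           ∎
  where
  open ≡-Reasoning
  off-a : ∀ k → k < N → k ≢ a → b k ∧ (k ≡ᵇ a) ≡ false
  off-a k _ k≢a = trans (cong (b k ∧_) (≢⇒≡ᵇ-false k≢a)) (∧-zeroʳ (b k))

xorSum-+ : ∀ g a b → xorSum g (a + b) ≡ xorSum g a xor (⨁[ k < b ] g (a + k))
xorSum-+ g a zero    = trans (cong (xorSum g) (+-identityʳ a)) (sym (xor-identityʳ _))
xorSum-+ g a (suc b) rewrite +-suc a b =
  trans (cong (_xor g (a + b)) (xorSum-+ g a b)) (xor-assoc (xorSum g a) _ _)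

xorSum-extend : ∀ g a d → (∀ j → j < d → g (a + j) ≡ false) → xorSum g (a + d) ≡ xorSum g a
xorSum-extend g a d g≡f =
  trans (xorSum-+ g a d) (trans (cong (xorSum g a xor_) (xorSum-false _ d g≡f)) (xor-identityʳ _))

xorSum-swap : ∀ (c : ℕ → ℕ → Bool) m n → (⨁[ a < m ] ⨁[ b < n ] c a b) ≡ (⨁[ b < n ] ⨁[ a < m ] c a b)
xorSum-swap c zero    n = sym (xorSum-false (λ _ → false) n (λ _ _ → refl))
xorSum-swap c (suc m) n =
  trans (cong (_xor xorSum (c m) n) (xorSum-swap c m n)) (sym (xorSum-xor n))

xorSum-suc : ∀ g n → xorSum g (suc n) ≡ g 0 xor xorSum (g ∘ suc) n
xorSum-suc g zero    = xor-comm false (g 0)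
xorSum-suc g (suc n) = trans (cong (_xor g (suc n)) (xorSum-suc g n)) (xor-assoc (g 0) _ _)

foldr-xor-upTo : ∀ g n → foldr _xor_ false (map g (upTo n)) ≡ xorSum g n
foldr-xor-upTo g n = trans (cong (foldr _xor_ false) (map-upTo g n)) (xor-applyUpTo g n)
  where
  xor-applyUpTo : ∀ g n → foldr _xor_ false (applyUpTo g n) ≡ xorSum g n
  xor-applyUpTo g zero    = refl
  xor-applyUpTo g (suc n) = trans (cong (g 0 xor_) (xor-applyUpTo (g ∘ suc) n)) (sym (xorSum-suc g n))

xorSum-split : ∀ (g p : ℕ → Bool) n → xorSum g n ≡ (⨁[ k < n ] (g k ∧ not (p k))) xor (⨁[ k < n ] (g k ∧ p k))
xorSum-split g p n = trans (xorSum-ext n split) (xorSum-xor n)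
  where
  split : ∀ k → g k ≡ (g k ∧ not (p k)) xor (g k ∧ p k)
  split k = begin
    g k                                 ≡⟨ ∧-identityʳ (g k) ⟨
    g k ∧ true                          ≡⟨ cong (g k ∧_) (xor-inverseˡ (p k)) ⟨
    g k ∧ (not (p k) xor p k)           ≡⟨ ∧-distribˡ-xor (g k) (not (p k)) (p k) ⟩
    (g k ∧ not (p k)) xor (g k ∧ p k)   ∎
    where open ≡-Reasoning

xorSum-remove : ∀ g n i → i < n → xorSum g n ≡ (⨁[ k < n ] (g k ∧ not (k ≡ᵇ i))) xor g i
xorSum-remove g n i i<n =
  trans (xorSum-split g (_≡ᵇ i) n)
        (cong (xorSum (λ k → g k ∧ not (k ≡ᵇ i)) n xor_) (xorSum-select g i n (⊥-elim ∘ <⇒≱ i<n)))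

InvolutionOn : (ℕ → Bool) → (ℕ → ℕ) → ℕ → Set
InvolutionOn g τ N = ∀ k → k < N → g k ≡ true → τ k < N × g (τ k) ≡ true × τ (τ k) ≡ k

-- Strip off the largest element N of the support together with its partner τ N < N.
xorSum-fixedPointFree : ∀ g τ N → InvolutionOn g τ N → (∀ k → k < N → g k ≡ true → τ k ≢ k) → xorSum g N ≡ false
xorSum-fixedPointFree g τ zero    _   _    = refl
xorSum-fixedPointFree g τ (suc N) inv free with g N in gN
... | false = cong (_xor false) (xorSum-fixedPointFree g τ N inv′ (λ k k<N → free k (m<n⇒m<1+n k<N)))
  where
  inv′ : InvolutionOn g τ N
  inv′ k k<N gk with inv k (m<n⇒m<1+n k<N) gk
  ... | τk<1+N , gτk , ττk = ≤∧≢⇒< (≤-pred τk<1+N) (λ { refl → case trans (sym gN) gτk of λ () }) , gτk , ττk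
... | true = begin
  xorSum g N xor true           ≡⟨ cong (_xor true) (xorSum-remove g N i i<N) ⟩
  (xorSum g′ N xor g i) xor true ≡⟨ cong (λ b → (xorSum g′ N xor b) xor true) gi ⟩
  (xorSum g′ N xor true) xor true ≡⟨ xor-assoc (xorSum g′ N) true true ⟩
  xorSum g′ N xor false          ≡⟨ xor-identityʳ _ ⟩
  xorSum g′ N                    ≡⟨ xorSum-fixedPointFree g′ τ N inv′ free′ ⟩
  false                          ∎
  where
  open ≡-Reasoning
  i : ℕ
  i = τ N
  i<N : i < N
  i<N = ≤∧≢⇒< (≤-pred (proj₁ (inv N (n<1+n N) gN))) (free N (n<1+n N) gN)
  gi : g i ≡ true
  gi = proj₁ (proj₂ (inv N (n<1+n N) gN))
  τi : τ i ≡ N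
  τi = proj₂ (proj₂ (inv N (n<1+n N) gN))
  g′ : ℕ → Bool
  g′ k = g k ∧ not (k ≡ᵇ i)
  g′⇒g : ∀ {k} → g′ k ≡ true → g k ≡ true × k ≢ i
  g′⇒g g′k = let gk , k≢ᵇi = ∧-not-true g′k in gk , ≡ᵇ-false⇒≢ k≢ᵇi
  inv′ : InvolutionOn g′ τ N
  inv′ k k<N g′k with g′⇒g g′k
  ... | gk , k≢i with inv k (m<n⇒m<1+n k<N) gk
  ...   | τk<1+N , gτk , ττk = τk<N , g′τk , ττk
    where
    τk≢N : τ k ≢ N
    τk≢N τk≡N = k≢i (trans (sym ττk) (cong τ τk≡N))
    τk<N : τ k < N
    τk<N = ≤∧≢⇒< (≤-pred τk<1+N) τk≢N
    g′τk : g′ (τ k) ≡ true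
    g′τk rewrite gτk | ≢⇒≡ᵇ-false {τ k} {i} (λ τk≡i → <⇒≢ k<N (trans (sym ττk) (trans (cong τ τk≡i) τi))) = refl
  free′ : ∀ k → k < N → g′ k ≡ true → τ k ≢ k
  free′ k k<N g′k = free k (m<n⇒m<1+n k<N) (proj₁ (g′⇒g g′k))

xorSum-involution : ∀ g τ N → InvolutionOn g τ N → xorSum g N ≡ ⨁[ k < N ] (g k ∧ (τ k ≡ᵇ k))
xorSum-involution g τ N inv = begin
  xorSum g N                                      ≡⟨ xorSum-split g fixed N ⟩
  xorSum moved N xor (⨁[ k < N ] (g k ∧ fixed k)) ≡⟨ cong (_xor xorSum fixedOnly N) (xorSum-fixedPointFree moved τ N inv′ free) ⟩
  ⨁[ k < N ] (g k ∧ fixed k)                      ∎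
  where
  open ≡-Reasoning
  fixed moved fixedOnly : ℕ → Bool
  fixed k = τ k ≡ᵇ k
  moved k = g k ∧ not (fixed k)
  fixedOnly k = g k ∧ fixed k
  moved⇒ : ∀ {k} → moved k ≡ true → g k ≡ true × τ k ≢ k
  moved⇒ mk = let gk , τk≢ᵇk = ∧-not-true mk in gk , ≡ᵇ-false⇒≢ τk≢ᵇk
  inv′ : InvolutionOn moved τ N
  inv′ k k<N mk with moved⇒ mk
  ... | gk , τk≢k with inv k k<N gk
  ...   | τk<N , gτk , ττk = τk<N , mτk , ττk
    where
    mτk : moved (τ k) ≡ true
    mτk rewrite gτk | ττk | ≢⇒≡ᵇ-false (τk≢k ∘ sym) = refl
  free : ∀ k → k < N → moved k ≡ true → τ k ≢ k
  free k _ mk = proj₂ (moved⇒ mk)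

_≟²_ : DecidableEquality (ℕ × ℕ)
_≟²_ = ≡-dec _≟_ _≟_

isFixed : (ℕ × ℕ → ℕ × ℕ) → ℕ × ℕ → Bool
isFixed s p = does (s p ≟² p)

module PairEncoding (M : ℕ) .{{_ : NonZero M}} where

  encode : ℕ × ℕ → ℕ
  encode (x , y) = y + x * M

  decode : ℕ → ℕ × ℕ
  decode p = p / M , p % M

  decode-encode : ∀ x y → y < M → decode (encode (x , y)) ≡ (x , y)
  decode-encode x y y<M = cong₂ _,_ quotient remainder
    where
    remainder : (y + x * M) % M ≡ y
    remainder = trans ([m+kn]%n≡m%n y x M) (m<n⇒m%n≡m y<M)
    quotient : (y + x * M) / M ≡ x
    quotient = begin
      (y + x * M) / M       ≡⟨ +-distrib-/ y (x * M) (subst (_< M) (sym small) y<M) ⟩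
      y / M + x * M / M     ≡⟨ cong₂ _+_ (m<n⇒m/n≡0 y<M) (m*n/n≡m x M) ⟩
      x                     ∎
      where
      open ≡-Reasoning
      small : y % M + x * M % M ≡ y
      small = trans (cong₂ _+_ (m<n⇒m%n≡m y<M) (m*n%n≡0 x M)) (+-identityʳ y)

  encode-decode : ∀ p → encode (decode p) ≡ p
  encode-decode p = sym (m≡m%n+[m/n]*n p M)

  encode-injective : ∀ {p q} → proj₂ p < M → proj₂ q < M → encode p ≡ encode q → p ≡ q
  encode-injective {x , y} {x′ , y′} y<M y′<M eq =
    trans (sym (decode-encode x y y<M)) (trans (cong decode eq) (decode-encode x′ y′ y′<M))

  encode-< : ∀ {K x y} → x < K → y < M → encode (x , y) < K * M
  encode-< {K} {x} x<K y<M = ≤-trans (+-monoˡ-< (x * M) y<M) (*-monoˡ-≤ M x<K)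

  xorSum-decode : ∀ K (c : ℕ × ℕ → Bool) → (⨁[ x < K ] ⨁[ y < M ] c (x , y)) ≡ ⨁[ p < K * M ] c (decode p)
  xorSum-decode zero    c = refl
  xorSum-decode (suc K) c = begin
    (⨁[ x < K ] ⨁[ y < M ] c (x , y)) xor (⨁[ y < M ] c (K , y))  ≡⟨ cong₂ _xor_ (xorSum-decode K c) (xorSum-cong M last-row) ⟩
    xorSum (c ∘ decode) (K * M) xor (⨁[ y < M ] c (decode (K * M + y)))  ≡⟨ xorSum-+ (c ∘ decode) (K * M) M ⟨
    xorSum (c ∘ decode) (K * M + M)                                ≡⟨ cong (xorSum (c ∘ decode)) (+-comm (K * M) M) ⟩
    xorSum (c ∘ decode) (suc K * M)                                ∎
    where
    open ≡-Reasoning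
    last-row : ∀ y → y < M → c (K , y) ≡ c (decode (K * M + y))
    last-row y y<M = cong c (sym (trans (cong decode (+-comm (K * M) y)) (decode-encode K y y<M)))

xorSum²-involution : ∀ M (c : ℕ × ℕ → Bool) (s : ℕ × ℕ → ℕ × ℕ) →
  (∀ p → c p ≡ true → proj₁ p < M × proj₂ p < M) →
  (∀ p → c p ≡ true → c (s p) ≡ true) →
  (∀ p → s (s p) ≡ p) →
  (⨁[ x < M ] ⨁[ y < M ] c (x , y)) ≡ (⨁[ x < M ] ⨁[ y < M ] (c (x , y) ∧ isFixed s (x , y)))
xorSum²-involution zero      c s bounded closed involutive = refl
xorSum²-involution M@(suc _) c s bounded closed involutive = begin
  (⨁[ x < M ] ⨁[ y < M ] c (x , y))                      ≡⟨ xorSum-decode M c ⟩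
  ⨁[ p < M * M ] g p                                      ≡⟨ xorSum-involution g τ (M * M) τ-involution ⟩
  ⨁[ p < M * M ] (g p ∧ (τ p ≡ᵇ p))                       ≡⟨ xorSum-ext (M * M) same-fixed-points ⟩
  ⨁[ p < M * M ] (g p ∧ isFixed s (decode p))             ≡⟨ xorSum-decode M (λ q → c q ∧ isFixed s q) ⟨
  (⨁[ x < M ] ⨁[ y < M ] (c (x , y) ∧ isFixed s (x , y))) ∎
  where
  open ≡-Reasoning
  open PairEncoding M
  g : ℕ → Bool
  g p = c (decode p)
  τ : ℕ → ℕ
  τ p = encode (s (decode p))
  decode-encode′ : ∀ q → c q ≡ true → decode (encode q) ≡ q
  decode-encode′ (x , y) cq = decode-encode x y (proj₂ (bounded (x , y) cq))
  τ-involution : InvolutionOn g τ (M * M)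
  τ-involution p _ gp = encode-< (proj₁ bound) (proj₂ bound) , g-τ , τ-τ
    where
    cs : c (s (decode p)) ≡ true
    cs = closed (decode p) gp
    bound : proj₁ (s (decode p)) < M × proj₂ (s (decode p)) < M
    bound = bounded (s (decode p)) cs
    g-τ : g (τ p) ≡ true
    g-τ = trans (cong c (decode-encode′ _ cs)) cs
    τ-τ : τ (τ p) ≡ p
    τ-τ = trans (cong (encode ∘ s) (decode-encode′ _ cs)) (trans (cong encode (involutive (decode p))) (encode-decode p))
  same-fixed-points : ∀ p → g p ∧ (τ p ≡ᵇ p) ≡ g p ∧ isFixed s (decode p)
  same-fixed-points p with g p in gp | s (decode p) ≟² decode p
  ... | false | _      = refl
  ... | true  | yes eq = dec-true (τ p ≟ p) (trans (cong encode eq) (encode-decode p))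
  ... | true  | no neq = dec-false (τ p ≟ p) λ τp≡p →
    neq (encode-injective (proj₂ (bounded _ (closed (decode p) gp))) (m%n<n p M) (trans τp≡p (sym (encode-decode p))))

infix 4 _≐_
_≐_ : PS → PS → Set
f ≐ g = ∀ n → f n ≡ g n

≐-refl : ∀ {f} → f ≐ f
≐-refl _ = refl

⊛-coeff : ∀ f g n → (f ⊛ g) n ≡ ⨁[ k < suc n ] (f k ∧ g (n ∸ k))
⊛-coeff f g n = foldr-xor-upTo (λ k → f k ∧ g (n ∸ k)) (suc n)

⊛-cong : ∀ {f f′ g g′} → f ≐ f′ → g ≐ g′ → f ⊛ g ≐ f′ ⊛ g′
⊛-cong {f} {f′} {g} {g′} f≐f′ g≐g′ n = begin
  (f ⊛ g) n                               ≡⟨ ⊛-coeff f g n ⟩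
  ⨁[ k < suc n ] (f k ∧ g (n ∸ k))        ≡⟨ xorSum-ext (suc n) (λ k → cong₂ _∧_ (f≐f′ k) (g≐g′ (n ∸ k))) ⟩
  ⨁[ k < suc n ] (f′ k ∧ g′ (n ∸ k))      ≡⟨ ⊛-coeff f′ g′ n ⟨
  (f′ ⊛ g′) n                             ∎
  where open ≡-Reasoning

^ₚ-cong : ∀ {f g} → f ≐ g → ∀ m → f ^ₚ m ≐ g ^ₚ m
^ₚ-cong f≐g zero    _ = refl
^ₚ-cong f≐g (suc m)   = ⊛-cong f≐g (^ₚ-cong f≐g m)

⊛-distribʳ-⊕ : ∀ f g h → (f ⊕ g) ⊛ h ≐ f ⊛ h ⊕ g ⊛ h
⊛-distribʳ-⊕ f g h n = begin
  ((f ⊕ g) ⊛ h) n                                                       ≡⟨ ⊛-coeff (f ⊕ g) h n ⟩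
  ⨁[ k < suc n ] ((f k xor g k) ∧ h (n ∸ k))                              ≡⟨ xorSum-ext (suc n) (λ k → ∧-distribʳ-xor (h (n ∸ k)) (f k) (g k)) ⟩
  ⨁[ k < suc n ] ((f k ∧ h (n ∸ k)) xor (g k ∧ h (n ∸ k)))                ≡⟨ xorSum-xor (suc n) ⟩
  (⨁[ k < suc n ] (f k ∧ h (n ∸ k))) xor (⨁[ k < suc n ] (g k ∧ h (n ∸ k))) ≡⟨ cong₂ _xor_ (⊛-coeff f h n) (⊛-coeff g h n) ⟨
  (f ⊛ h ⊕ g ⊛ h) n                                                     ∎
  where open ≡-Reasoning

⊛-distribˡ-⊕ : ∀ h f g → h ⊛ (f ⊕ g) ≐ h ⊛ f ⊕ h ⊛ g
⊛-distribˡ-⊕ h f g n = begin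
  (h ⊛ (f ⊕ g)) n                                                       ≡⟨ ⊛-coeff h (f ⊕ g) n ⟩
  ⨁[ k < suc n ] (h k ∧ (f (n ∸ k) xor g (n ∸ k)))                        ≡⟨ xorSum-ext (suc n) (λ k → ∧-distribˡ-xor (h k) (f (n ∸ k)) (g (n ∸ k))) ⟩
  ⨁[ k < suc n ] ((h k ∧ f (n ∸ k)) xor (h k ∧ g (n ∸ k)))                ≡⟨ xorSum-xor (suc n) ⟩
  (⨁[ k < suc n ] (h k ∧ f (n ∸ k))) xor (⨁[ k < suc n ] (h k ∧ g (n ∸ k))) ≡⟨ cong₂ _xor_ (⊛-coeff h f n) (⊛-coeff h g n) ⟨
  (h ⊛ f ⊕ h ⊛ g) n                                                     ∎
  where open ≡-Reasoning

⊛-identityʳ : ∀ f → f ⊛ one ≐ f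
⊛-identityʳ f n = begin
  (f ⊛ one) n                          ≡⟨ ⊛-coeff f one n ⟩
  ⨁[ k < suc n ] (f k ∧ one (n ∸ k))   ≡⟨ xorSum-single _ (suc n) n (n<1+n n) off-diagonal ⟩
  f n ∧ one (n ∸ n)                    ≡⟨ cong (λ m → f n ∧ one m) (n∸n≡0 n) ⟩
  f n ∧ true                           ≡⟨ ∧-identityʳ (f n) ⟩
  f n                                  ∎
  where
  open ≡-Reasoning
  off-diagonal : ∀ k → k < suc n → k ≢ n → f k ∧ one (n ∸ k) ≡ false
  off-diagonal k k<1+n k≢n with n ∸ k | m<n⇒0<n∸m (≤∧≢⇒< (≤-pred k<1+n) k≢n)
  ... | suc _ | _ = ∧-zeroʳ (f k)

xorSum-triangle : ∀ (c : ℕ → ℕ → Bool) n →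
  (⨁[ i < n ] ⨁[ k < suc i ] c k i) ≡ (⨁[ k < n ] ⨁[ j < n ∸ k ] c k (k + j))
xorSum-triangle c n = begin
  (⨁[ i < n ] ⨁[ k < suc i ] c k i) ≡⟨ xorSum-cong n (λ i i<n → guard-rows i i<n) ⟩
  (⨁[ i < n ] ⨁[ k < n ] c̃ k i)     ≡⟨ xorSum-swap (λ i k → c̃ k i) n n ⟩
  (⨁[ k < n ] ⨁[ i < n ] c̃ k i)     ≡⟨ xorSum-cong n (λ k k<n → guard-columns k k<n) ⟩
  (⨁[ k < n ] ⨁[ j < n ∸ k ] c k (k + j)) ∎
  where
  open ≡-Reasoning
  c̃ : ℕ → ℕ → Bool
  c̃ k i = (k ≤ᵇ i) ∧ c k i
  guard-rows : ∀ i → i < n → (⨁[ k < suc i ] c k i) ≡ (⨁[ k < n ] c̃ k i)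
  guard-rows i i<n = begin
    (⨁[ k < suc i ] c k i)                 ≡⟨ xorSum-cong (suc i) (λ k k≤i → cong (_∧ c k i) (dec-true (k ≤? i) (≤-pred k≤i)))
                                              ⟨
    (⨁[ k < suc i ] c̃ k i)                 ≡⟨ xorSum-extend (λ k → c̃ k i) (suc i) (n ∸ suc i)
                                                (λ j _ → cong (_∧ c (suc i + j) i) (dec-false (suc i + j ≤? _) (<⇒≱ (s≤s (m≤m+n i j)))))
                                              ⟨
    (⨁[ k < suc i + (n ∸ suc i) ] c̃ k i)   ≡⟨ cong (λ m → ⨁[ k < m ] c̃ k i) (m+[n∸m]≡n i<n) ⟩
    (⨁[ k < n ] c̃ k i)                     ∎
  guard-columns : ∀ k → k < n → (⨁[ i < n ] c̃ k i) ≡ (⨁[ j < n ∸ k ] c k (k + j))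
  guard-columns k k<n = begin
    (⨁[ i < n ] c̃ k i)                           ≡⟨ cong (λ m → ⨁[ i < m ] c̃ k i) (m+[n∸m]≡n (<⇒≤ k<n)) ⟨
    (⨁[ i < k + (n ∸ k) ] c̃ k i)                 ≡⟨ xorSum-+ (c̃ k) k (n ∸ k) ⟩
    xorSum (c̃ k) k xor (⨁[ j < n ∸ k ] c̃ k (k + j)) ≡⟨ cong₂ _xor_ below-diagonal (xorSum-ext (n ∸ k) on-diagonal) ⟩
    false xor (⨁[ j < n ∸ k ] c k (k + j))        ∎
    where
    below-diagonal : xorSum (c̃ k) k ≡ false
    below-diagonal = xorSum-false (c̃ k) k (λ i i<k → cong (_∧ c k i) (dec-false (k ≤? i) (<⇒≱ i<k)))
    on-diagonal : ∀ j → c̃ k (k + j) ≡ c k (k + j)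
    on-diagonal j = cong (_∧ c k (k + j)) (dec-true (k ≤? k + j) (m≤m+n k j))

⊛-assoc : ∀ f g h → f ⊛ (g ⊛ h) ≐ (f ⊛ g) ⊛ h
⊛-assoc f g h n = begin
  (f ⊛ (g ⊛ h)) n                                                    ≡⟨ ⊛-coeff f (g ⊛ h) n ⟩
  ⨁[ k < suc n ] (f k ∧ (g ⊛ h) (n ∸ k))                             ≡⟨ xorSum-cong (suc n) inner-left ⟩
  ⨁[ k < suc n ] ⨁[ j < suc n ∸ k ] c k (k + j)                      ≡⟨ xorSum-triangle c (suc n) ⟨
  ⨁[ i < suc n ] ⨁[ k < suc i ] c k i                                ≡⟨ xorSum-ext (suc n) inner-right ⟩
  ⨁[ i < suc n ] ((f ⊛ g) i ∧ h (n ∸ i))                             ≡⟨ ⊛-coeff (f ⊛ g) h n ⟨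
  ((f ⊛ g) ⊛ h) n                                                    ∎
  where
  open ≡-Reasoning
  c : ℕ → ℕ → Bool
  c k i = (f k ∧ g (i ∸ k)) ∧ h (n ∸ i)
  inner-left : ∀ k → k < suc n → f k ∧ (g ⊛ h) (n ∸ k) ≡ ⨁[ j < suc n ∸ k ] c k (k + j)
  inner-left k k<1+n = begin
    f k ∧ (g ⊛ h) (n ∸ k)                              ≡⟨ cong (f k ∧_) (⊛-coeff g h (n ∸ k)) ⟩
    f k ∧ (⨁[ j < suc (n ∸ k) ] (g j ∧ h (n ∸ k ∸ j))) ≡⟨ ∧-distribˡ-xorSum (f k) _ (suc (n ∸ k)) ⟩
    ⨁[ j < suc (n ∸ k) ] (f k ∧ (g j ∧ h (n ∸ k ∸ j))) ≡⟨ cong (xorSum _) (+-∸-assoc 1 (≤-pred k<1+n)) ⟨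
    ⨁[ j < suc n ∸ k ] (f k ∧ (g j ∧ h (n ∸ k ∸ j)))   ≡⟨ xorSum-ext (suc n ∸ k) reindex ⟩
    ⨁[ j < suc n ∸ k ] c k (k + j)                     ∎
    where
    reindex : ∀ j → f k ∧ (g j ∧ h (n ∸ k ∸ j)) ≡ c k (k + j)
    reindex j rewrite m+n∸m≡n k j | ∸-+-assoc n k j = sym (∧-assoc (f k) (g j) _)
  inner-right : ∀ i → (⨁[ k < suc i ] c k i) ≡ (f ⊛ g) i ∧ h (n ∸ i)
  inner-right i = begin
    ⨁[ k < suc i ] c k i                          ≡⟨ ∧-distribʳ-xorSum (h (n ∸ i)) _ (suc i) ⟨
    (⨁[ k < suc i ] (f k ∧ g (i ∸ k))) ∧ h (n ∸ i) ≡⟨ cong (_∧ h (n ∸ i)) (⊛-coeff f g i) ⟨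
    (f ⊛ g) i ∧ h (n ∸ i)                          ∎

-- f(q²), with the coefficient read off without division.
dilate : PS → PS
dilate f n = ⨁[ k < suc n ] (f k ∧ (n ≡ᵇ k + k))

dilate-cong : ∀ {f g} → f ≐ g → dilate f ≐ dilate g
dilate-cong f≐g n = xorSum-ext (suc n) (λ k → cong (_∧ _) (f≐g k))

dilate-⊕ : ∀ f g → dilate (f ⊕ g) ≐ dilate f ⊕ dilate g
dilate-⊕ f g n = trans (xorSum-ext (suc n) (λ k → ∧-distribʳ-xor _ (f k) (g k))) (xorSum-xor (suc n))

-- Frobenius: the terms k and n ∸ k of the Cauchy product cancel in pairs.
⊛-self : ∀ f → f ⊛ f ≐ dilate f
⊛-self f n = begin
  (f ⊛ f) n                                   ≡⟨ ⊛-coeff f f n ⟩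
  ⨁[ k < suc n ] g k                          ≡⟨ xorSum-involution g (n ∸_) (suc n) reflect ⟩
  ⨁[ k < suc n ] (g k ∧ (n ∸ k ≡ᵇ k))          ≡⟨ xorSum-cong (suc n) (λ k k<1+n → on-diagonal k (≤-pred k<1+n)) ⟩
  dilate f n                                  ∎
  where
  open ≡-Reasoning
  g : ℕ → Bool
  g k = f k ∧ f (n ∸ k)
  reflect : InvolutionOn g (n ∸_) (suc n)
  reflect k k<1+n gk = s≤s (m∸n≤m n k) , g-sym , m∸[m∸n]≡n (≤-pred k<1+n)
    where
    g-sym : g (n ∸ k) ≡ true
    g-sym rewrite m∸[m∸n]≡n (≤-pred k<1+n) = trans (∧-comm (f (n ∸ k)) (f k)) gk
  on-diagonal : ∀ k → k ≤ n → g k ∧ (n ∸ k ≡ᵇ k) ≡ f k ∧ (n ≡ᵇ k + k)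
  on-diagonal k k≤n with n ≟ k + k
  ... | yes refl rewrite m+n∸n≡m k k | ≡ᵇ-refl k | ≡ᵇ-refl (k + k) = cong (_∧ true) (∧-idem (f k))
  ... | no n≢k+k rewrite ≢⇒≡ᵇ-false n≢k+k
                       | ≢⇒≡ᵇ-false {n ∸ k} {k} (λ n∸k≡k → n≢k+k (trans (sym (m∸n+n≡m k≤n)) (cong (_+ k) n∸k≡k)))
                       = trans (∧-assoc (f k) _ false) (cong (f k ∧_) (∧-zeroʳ _))

^4≐dilate² : ∀ f → f ^ₚ 4 ≐ dilate (dilate f)
^4≐dilate² f n = begin
  (f ⊛ (f ⊛ (f ⊛ (f ⊛ one)))) n  ≡⟨ ⊛-cong (≐-refl {f}) (⊛-cong (≐-refl {f}) (⊛-cong (≐-refl {f}) (⊛-identityʳ f))) n ⟩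
  (f ⊛ (f ⊛ (f ⊛ f))) n          ≡⟨ ⊛-cong (≐-refl {f}) (⊛-assoc f f f) n ⟩
  (f ⊛ ((f ⊛ f) ⊛ f)) n          ≡⟨ ⊛-assoc f (f ⊛ f) f n ⟩
  ((f ⊛ (f ⊛ f)) ⊛ f) n          ≡⟨ ⊛-cong (⊛-assoc f f f) (≐-refl {f}) n ⟩
  (((f ⊛ f) ⊛ f) ⊛ f) n          ≡⟨ ⊛-assoc (f ⊛ f) f f n ⟨
  ((f ⊛ f) ⊛ (f ⊛ f)) n          ≡⟨ ⊛-cong (⊛-self f) (⊛-self f) n ⟩
  (dilate f ⊛ dilate f) n        ≡⟨ ⊛-self (dilate f) n ⟩
  dilate (dilate f) n            ∎
  where open ≡-Reasoning

⊛-cancelˡ : ∀ f z → f 0 ≡ false → f 1 ≡ true → f ⊛ z ≐ zeroPS → z ≐ zeroPS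
⊛-cancelˡ f z f₀ f₁ fz≐0 = <-rec (λ n → z n ≡ false) step
  where
  step : ∀ n → (∀ {m} → m < n → z m ≡ false) → z n ≡ false
  step n ih = begin
    z n                                              ≡⟨ cong (_∧ z n) f₁ ⟨
    f 1 ∧ z (suc n ∸ 1)                              ≡⟨ xorSum-single _ (2 + n) 1 (s≤s (s≤s z≤n)) only-k≡1 ⟨
    ⨁[ k < suc (suc n) ] (f k ∧ z (suc n ∸ k))       ≡⟨ ⊛-coeff f z (suc n) ⟨
    (f ⊛ z) (suc n)                                  ≡⟨ fz≐0 (suc n) ⟩
    false                                            ∎
    where
    open ≡-Reasoning
    only-k≡1 : ∀ k → k < 2 + n → k ≢ 1 → f k ∧ z (suc n ∸ k) ≡ false
    only-k≡1 zero          _                 _   = cong (_∧ z (suc n)) f₀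
    only-k≡1 (suc zero)    _                 k≢1 = ⊥-elim (k≢1 refl)
    only-k≡1 (suc (suc k)) (s≤s (s≤s k<n)) _   = trans (cong (f (2 + k) ∧_) (ih (∸-monoʳ-< {n} (s≤s z≤n) k<n))) (∧-zeroʳ _)

^4-⊕ : ∀ f g → (f ⊕ g) ^ₚ 4 ≐ f ^ₚ 4 ⊕ g ^ₚ 4
^4-⊕ f g n = begin
  ((f ⊕ g) ^ₚ 4) n                                 ≡⟨ ^4≐dilate² (f ⊕ g) n ⟩
  dilate (dilate (f ⊕ g)) n                        ≡⟨ dilate-cong (dilate-⊕ f g) n ⟩
  dilate (dilate f ⊕ dilate g) n                   ≡⟨ dilate-⊕ (dilate f) (dilate g) n ⟩
  dilate (dilate f) n xor dilate (dilate g) n      ≡⟨ cong₂ _xor_ (^4≐dilate² f n) (^4≐dilate² g n) ⟨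
  (f ^ₚ 4 ⊕ g ^ₚ 4) n                              ∎
  where open ≡-Reasoning

oddSquare : ℕ → ℕ
oddSquare x = suc (2 * x) * suc (2 * x)

norm : ℕ × ℕ → ℕ
norm (x , y) = oddSquare x + 3 * oddSquare y

-- With a = 2x+1 and b = 2y+1, σ multiplies a + b√−3 by (1 + √−3)/2 when a ≡ b (mod 4), i.e. when
-- x + y is even, and by (1 − √−3)/2 otherwise; this keeps both coordinates odd, and σ then takes
-- their absolute values.
σ-on : Parity → ℕ → ℕ → ℕ × ℕ
σ-on 0ℙ x y = ⌊ ∣ x - suc (3 * y) ∣ /2⌋ , ⌊ x + y /2⌋
σ-on 1ℙ x y = ⌊ suc (x + 3 * y) /2⌋ , ⌊ ∣ x - y ∣ /2⌋

σ : ℕ × ℕ → ℕ × ℕ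
σ (x , y) = σ-on (parity (x + y)) x y

m+n≡m⇒n≡0 : ∀ {m n} → m + n ≡ m → n ≡ 0
m+n≡m⇒n≡0 {m} {n} eq = +-cancelˡ-≡ m n 0 (trans eq (sym (+-identityʳ m)))

parity-double : ∀ k → parity (k + k) ≡ 0ℙ
parity-double zero    = refl
parity-double (suc k) rewrite +-suc k k = parity-double k

parity-1+double : ∀ k → parity (suc (k + k)) ≡ 1ℙ
parity-1+double zero    = refl
parity-1+double (suc k) rewrite +-suc k k = parity-1+double k

⌊1+n+n/2⌋≡n : ∀ n → ⌊ suc (n + n) /2⌋ ≡ n
⌊1+n+n/2⌋≡n zero    = refl
⌊1+n+n/2⌋≡n (suc n) rewrite +-suc n n = cong suc (⌊1+n+n/2⌋≡n n)

⌊∣m-m+1+2k∣/2⌋ : ∀ m {n k} → n ≡ m + suc (k + k) → ⌊ ∣ m - n ∣ /2⌋ ≡ k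
⌊∣m-m+1+2k∣/2⌋ m {k = k} refl = trans (cong ⌊_/2⌋ (∣m-m+n∣≡n m (suc (k + k)))) (⌊1+n+n/2⌋≡n k)

⌊∣m+1+2k-m∣/2⌋ : ∀ m n {k} → m ≡ n + suc (k + k) → ⌊ ∣ m - n ∣ /2⌋ ≡ k
⌊∣m+1+2k-m∣/2⌋ m n m≡ = trans (cong ⌊_/2⌋ (∣-∣-comm m n)) (⌊∣m-m+1+2k∣/2⌋ n m≡)

σ-even : ∀ x y {x′ y′} → x + y ≡ y′ + y′ → ⌊ ∣ x - suc (3 * y) ∣ /2⌋ ≡ x′ → σ (x , y) ≡ (x′ , y′)
σ-even x y {y′ = y′} x+y≡ eq₁ =
  trans (cong (λ p → σ-on p x y) (trans (cong parity x+y≡) (parity-double y′)))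
        (cong₂ _,_ eq₁ (trans (cong ⌊_/2⌋ x+y≡) (sym (n≡⌊n+n/2⌋ y′))))

σ-odd : ∀ x y {x′ y′} k → x + y ≡ suc (k + k) → suc (x + 3 * y) ≡ x′ + x′ → ⌊ ∣ x - y ∣ /2⌋ ≡ y′ →
        σ (x , y) ≡ (x′ , y′)
σ-odd x y {x′} k x+y≡ eq₁ eq₂ =
  trans (cong (λ p → σ-on p x y) (trans (cong parity x+y≡) (parity-1+double k)))
        (cong₂ _,_ (trans (cong ⌊_/2⌋ eq₁) (sym (n≡⌊n+n/2⌋ x′))) eq₂)

σ-A₁ : ∀ u c → σ (u , u + 2 * c) ≡ (u + 3 * c , u + c)
σ-A₁ u c = σ-even u (u + 2 * c) (solve (u ∷ c ∷ [])) (⌊∣m-m+1+2k∣/2⌋ u (solve (u ∷ c ∷ [])))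

σ-A₂ : ∀ u c → σ (u + 3 * c , u + c) ≡ (u , u + 2 * c)
σ-A₂ u c = σ-even (u + 3 * c) (u + c) (solve (u ∷ c ∷ [])) (⌊∣m-m+1+2k∣/2⌋ (u + 3 * c) (solve (u ∷ c ∷ [])))

σ-B₁ : ∀ a j → σ (a , a + suc (2 * j)) ≡ (2 * a + 3 * j + 2 , j)
σ-B₁ a j = σ-odd a (a + suc (2 * j)) (a + j) (solve (a ∷ j ∷ [])) (solve (a ∷ j ∷ []))
                 (⌊∣m-m+1+2k∣/2⌋ a (solve (a ∷ j ∷ [])))

σ-B₂ : ∀ a j → σ (2 * a + 3 * j + 2 , j) ≡ (a , a + suc (2 * j))
σ-B₂ a j = σ-even (2 * a + 3 * j + 2) j (solve (a ∷ j ∷ []))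
                  (⌊∣m+1+2k-m∣/2⌋ (2 * a + 3 * j + 2) (suc (3 * j)) (solve (a ∷ j ∷ [])))

σ-C₁ : ∀ j g → σ (3 * j + 1 + g , j + g) ≡ (3 * j + 1 + 2 * g , j)
σ-C₁ j g = σ-odd (3 * j + 1 + g) (j + g) (2 * j + g) (solve (j ∷ g ∷ [])) (solve (j ∷ g ∷ []))
                 (⌊∣m+1+2k-m∣/2⌋ (3 * j + 1 + g) (j + g) (solve (j ∷ g ∷ [])))

σ-C₂ : ∀ j g → σ (3 * j + 1 + 2 * g , j) ≡ (3 * j + 1 + g , j + g)
σ-C₂ j g = σ-odd (3 * j + 1 + 2 * g) j (2 * j + g) (solve (j ∷ g ∷ [])) (solve (j ∷ g ∷ []))
                 (⌊∣m+1+2k-m∣/2⌋ (3 * j + 1 + 2 * g) j (solve (j ∷ g ∷ [])))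

-- σ is affine on each region, mapping X₁ onto X₂ and X₂ onto X₁.
data Region : ℕ → ℕ → Set where
  A₁ : ∀ u c → Region u (u + 2 * c)
  A₂ : ∀ u c → Region (u + 3 * c) (u + c)
  B₁ : ∀ a j → Region a (a + suc (2 * j))
  B₂ : ∀ a j → Region (2 * a + 3 * j + 2) j
  C₁ : ∀ j g → Region (3 * j + 1 + g) (j + g)
  C₂ : ∀ j g → Region (3 * j + 1 + 2 * g) j

even-or-odd : ∀ n → (∃[ h ] n ≡ h + h) ⊎ (∃[ h ] n ≡ suc (h + h))
even-or-odd zero = inj₁ (0 , refl)
even-or-odd (suc n) with even-or-odd n
... | inj₁ (h , refl) = inj₂ (h , refl)
... | inj₂ (h , refl) = inj₁ (suc h , cong suc (sym (+-suc h h)))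

region : ∀ x y → Region x y
region x y with x ≤? y
... | yes x≤y with m≤n⇒∃[o]m+o≡n x≤y
...   | d , refl with even-or-odd d
...     | inj₁ (h , refl) = subst (Region x) {x + 2 * h} (solve (x ∷ h ∷ [])) (A₁ x h)
...     | inj₂ (h , refl) = subst (Region x) {x + suc (2 * h)} (solve (x ∷ h ∷ [])) (B₁ x h)
region x y | no x≰y with m≤n⇒∃[o]m+o≡n (≰⇒> x≰y)
...   | d , refl with even-or-odd d
...     | inj₁ (h , refl) with y ≤? h
...       | yes y≤h with m≤n⇒∃[o]m+o≡n y≤h
...         | g , refl = subst (λ z → Region z y) {3 * y + 1 + 2 * g} (solve (y ∷ g ∷ [])) (C₂ y g)
region x y | no _ | d , refl | inj₁ (h , refl) | no y≰h with m≤n⇒∃[o]m+o≡n (<⇒≤ (≰⇒> y≰h))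
...         | g , refl = subst₂ Region {3 * h + 1 + g} (solve (h ∷ g ∷ [])) refl (C₁ h g)
region x y | no _ | d , refl | inj₂ (h , refl) with y ≤? h
...       | yes y≤h with m≤n⇒∃[o]m+o≡n y≤h
...         | a , refl = subst (λ z → Region z y) {2 * a + 3 * y + 2} (solve (y ∷ a ∷ [])) (B₂ a y)
region x y | no _ | d , refl | inj₂ (h , refl) | no y≰h with m≤n⇒∃[o]m+o≡n (≰⇒> y≰h)
...         | u , refl =
  subst₂ Region {u + 3 * suc h} {_} {u + suc h} (solve (h ∷ u ∷ [])) (solve (h ∷ u ∷ [])) (A₂ u (suc h))

σ-involutive : ∀ p → σ (σ p) ≡ p
σ-involutive (x , y) with region x y
... | A₁ u c rewrite σ-A₁ u c = σ-A₂ u c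
... | A₂ u c rewrite σ-A₂ u c = σ-A₁ u c
... | B₁ a j rewrite σ-B₁ a j = σ-B₂ a j
... | B₂ a j rewrite σ-B₂ a j = σ-B₁ a j
... | C₁ j g rewrite σ-C₁ j g = σ-C₂ j g
... | C₂ j g rewrite σ-C₂ j g = σ-C₁ j g

norm-σ : ∀ p → norm (σ p) ≡ norm p
norm-σ (x , y) with region x y
... | A₁ u c rewrite σ-A₁ u c = solve (u ∷ c ∷ [])
... | A₂ u c rewrite σ-A₂ u c = solve (u ∷ c ∷ [])
... | B₁ a j rewrite σ-B₁ a j = solve (a ∷ j ∷ [])
... | B₂ a j rewrite σ-B₂ a j = solve (a ∷ j ∷ [])
... | C₁ j g rewrite σ-C₁ j g = solve (j ∷ g ∷ [])
... | C₂ j g rewrite σ-C₂ j g = solve (j ∷ g ∷ [])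

σ-diagonal : ∀ x → σ (x , x) ≡ (x , x)
σ-diagonal x = σ-even x x refl (⌊∣m-m+1+2k∣/2⌋ x (solve (x ∷ [])))

σ-line : ∀ y → σ (3 * y + 1 , y) ≡ (3 * y + 1 , y)
σ-line y = σ-odd (3 * y + 1) y (2 * y) (solve (y ∷ [])) (solve (y ∷ [])) (⌊∣m+1+2k-m∣/2⌋ (3 * y + 1) y (solve (y ∷ [])))

σ-fixed : ∀ {x y} → σ (x , y) ≡ (x , y) → x ≡ y ⊎ x ≡ 3 * y + 1
σ-fixed {x} {y} eq with region x y
... | A₁ u c rewrite σ-A₁ u c with m+n≡0⇒m≡0 c (m+n≡m⇒n≡0 (,-injectiveˡ eq))
...   | refl = inj₁ (sym (+-identityʳ u))
σ-fixed eq | A₂ u c rewrite σ-A₂ u c with m+n≡0⇒m≡0 c (m+n≡m⇒n≡0 (sym (,-injectiveˡ eq)))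
...   | refl = inj₁ refl
σ-fixed eq | B₁ a j rewrite σ-B₁ a j =
  ⊥-elim (<-irrefl (,-injectiveʳ eq) (≤-trans (s≤s (m≤m+n j _)) (m≤n+m _ a)))
σ-fixed eq | B₂ a j rewrite σ-B₂ a j =
  ⊥-elim (<-irrefl (,-injectiveˡ eq) (≤-trans (m<m+n a {2} z<s) (+-monoˡ-≤ 2 (≤-trans (m≤m+n a _) (m≤m+n _ (3 * j))))))
σ-fixed eq | C₁ j g rewrite σ-C₁ j g with m+n≡m⇒n≡0 (sym (,-injectiveʳ eq))
...   | refl = inj₂ (solve (j ∷ []))
σ-fixed eq | C₂ j g rewrite σ-C₂ j g with m+n≡m⇒n≡0 (,-injectiveʳ eq)
...   | refl = inj₂ (solve (j ∷ []))

x≤oddSquare : ∀ x → x ≤ oddSquare x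
x≤oddSquare x = ≤-trans (m≤m+n x (x + 0)) (≤-trans (n≤1+n _) (m≤m*n (suc (2 * x)) (suc (2 * x))))

components≤norm : ∀ x y → x ≤ norm (x , y) × y ≤ norm (x , y)
components≤norm x y = ≤-trans (x≤oddSquare x) (m≤m+n _ _)
                    , ≤-trans (x≤oddSquare y) (≤-trans (m≤n*m (oddSquare y) 3) (m≤n+m _ (oddSquare x)))

norm-diagonal : ∀ x → norm (x , x) ≡ 4 * oddSquare x
norm-diagonal x = a+3a≡4a (oddSquare x)
  where
  a+3a≡4a : ∀ a → a + 3 * a ≡ 4 * a
  a+3a≡4a = solve-∀

norm-line : ∀ y → norm (3 * y + 1 , y) ≡ 12 * oddSquare y
norm-line = expanded
  where
  expanded : ∀ y → suc (2 * (3 * y + 1)) * suc (2 * (3 * y + 1)) + 3 * (suc (2 * y) * suc (2 * y))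
                 ≡ 12 * (suc (2 * y) * suc (2 * y))
  expanded = solve-∀

θ : ℕ → PS
θ T m = ⨁[ x < suc m ] (m ≡ᵇ T * oddSquare x)

x≤T*oddSquare : ∀ T .{{_ : NonZero T}} x → x ≤ T * oddSquare x
x≤T*oddSquare T x = ≤-trans (x≤oddSquare x) (m≤n*m _ T)

θ-extend : ∀ T .{{_ : NonZero T}} {k n} → k ≤ n → θ T k ≡ ⨁[ x < suc n ] (k ≡ᵇ T * oddSquare x)
θ-extend T {k} {n} k≤n = begin
  θ T k                                                       ≡⟨ xorSum-extend _ (suc k) (n ∸ k) too-large ⟨
  ⨁[ x < suc k + (n ∸ k) ] (k ≡ᵇ T * oddSquare x)             ≡⟨ cong (λ N → ⨁[ x < N ] (k ≡ᵇ T * oddSquare x)) (cong suc (m+[n∸m]≡n k≤n)) ⟩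
  ⨁[ x < suc n ] (k ≡ᵇ T * oddSquare x)                       ∎
  where
  open ≡-Reasoning
  too-large : ∀ j → j < n ∸ k → (k ≡ᵇ T * oddSquare (suc k + j)) ≡ false
  too-large j _ = ≢⇒≡ᵇ-false (<⇒≢ (≤-trans (s≤s (m≤m+n k j)) (x≤T*oddSquare T (suc k + j))))

θ-dilate : ∀ T .{{_ : NonZero T}} → dilate (θ T) ≐ θ (2 * T)
θ-dilate T n = begin
  dilate (θ T) n                                                          ≡⟨ xorSum-cong N expand ⟩
  ⨁[ k < N ] ⨁[ x < N ] ((k ≡ᵇ T * oddSquare x) ∧ (n ≡ᵇ k + k))           ≡⟨ xorSum-swap _ N N ⟩
  ⨁[ x < N ] ⨁[ k < N ] ((k ≡ᵇ T * oddSquare x) ∧ (n ≡ᵇ k + k))           ≡⟨ xorSum-ext N collapse ⟩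
  θ (2 * T) n                                                             ∎
  where
  open ≡-Reasoning
  N : ℕ
  N = suc n
  expand : ∀ k → k < N → θ T k ∧ (n ≡ᵇ k + k) ≡ ⨁[ x < N ] ((k ≡ᵇ T * oddSquare x) ∧ (n ≡ᵇ k + k))
  expand k k<N = trans (cong (_∧ (n ≡ᵇ k + k)) (θ-extend T (≤-pred k<N))) (∧-distribʳ-xorSum _ _ N)
  collapse : ∀ x → (⨁[ k < N ] ((k ≡ᵇ T * oddSquare x) ∧ (n ≡ᵇ k + k))) ≡ (n ≡ᵇ 2 * T * oddSquare x)
  collapse x = begin
    ⨁[ k < N ] ((k ≡ᵇ a) ∧ (n ≡ᵇ k + k)) ≡⟨ xorSum-ext N (λ k → ∧-comm (k ≡ᵇ a) _) ⟩
    ⨁[ k < N ] ((n ≡ᵇ k + k) ∧ (k ≡ᵇ a)) ≡⟨ xorSum-select (λ k → n ≡ᵇ k + k) a N (λ N≤a → ≢⇒≡ᵇ-false (<⇒≢ (≤-trans N≤a (m≤m+n a a)))) ⟩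
    (n ≡ᵇ a + a)                          ≡⟨ cong (n ≡ᵇ_) (a+a≡2*T*b T (oddSquare x)) ⟩
    (n ≡ᵇ 2 * T * oddSquare x)            ∎
    where
    a : ℕ
    a = T * oddSquare x
    a+a≡2*T*b : ∀ T b → T * b + T * b ≡ 2 * T * b
    a+a≡2*T*b T b = solve (T ∷ b ∷ [])

∸-≡ᵇ : ∀ m a {b} → 0 < b → (m ∸ a ≡ᵇ b) ≡ (m ≡ᵇ a + b)
∸-≡ᵇ m a {b} 0<b with m ≟ a + b
... | yes refl rewrite m+n∸m≡n a b = trans (≡ᵇ-refl b) (sym (≡ᵇ-refl (a + b)))
... | no m≢a+b = trans (≢⇒≡ᵇ-false m∸a≢b) (sym (≢⇒≡ᵇ-false m≢a+b))
  where
  m∸a≢b : m ∸ a ≢ b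
  m∸a≢b m∸a≡b with a ≤? m
  ... | yes a≤m = m≢a+b (trans (sym (m+[n∸m]≡n a≤m)) (cong (a +_) m∸a≡b))
  ... | no  a≰m = <⇒≢ 0<b (trans (sym (m≤n⇒m∸n≡0 (<⇒≤ (≰⇒> a≰m)))) m∸a≡b)

θ-product : ∀ U V .{{_ : NonZero U}} .{{_ : NonZero V}} m →
  (θ U ⊛ θ V) m ≡ ⨁[ x < suc m ] ⨁[ y < suc m ] (m ≡ᵇ U * oddSquare x + V * oddSquare y)
θ-product U V m = begin
  (θ U ⊛ θ V) m                                                         ≡⟨ ⊛-coeff (θ U) (θ V) m ⟩
  ⨁[ k < M ] (θ U k ∧ θ V (m ∸ k))                                       ≡⟨ xorSum-cong M expand ⟩
  ⨁[ k < M ] ⨁[ x < M ] ⨁[ y < M ] c k x y                               ≡⟨ xorSum-swap _ M M ⟩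
  ⨁[ x < M ] ⨁[ k < M ] ⨁[ y < M ] c k x y                               ≡⟨ xorSum-ext M (λ x → xorSum-swap (λ k y → c k x y) M M) ⟩
  ⨁[ x < M ] ⨁[ y < M ] ⨁[ k < M ] c k x y                               ≡⟨ xorSum-ext M (λ x → xorSum-ext M (collapse x)) ⟩
  ⨁[ x < M ] ⨁[ y < M ] (m ≡ᵇ U * oddSquare x + V * oddSquare y)         ∎
  where
  open ≡-Reasoning
  M : ℕ
  M = suc m
  c : ℕ → ℕ → ℕ → Bool
  c k x y = (k ≡ᵇ U * oddSquare x) ∧ (m ∸ k ≡ᵇ V * oddSquare y)
  expand : ∀ k → k < M → θ U k ∧ θ V (m ∸ k) ≡ ⨁[ x < M ] ⨁[ y < M ] c k x y
  expand k k<M = begin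
    θ U k ∧ θ V (m ∸ k)                                                       ≡⟨ cong₂ _∧_ (θ-extend U (≤-pred k<M)) (θ-extend V (m∸n≤m m k)) ⟩
    (⨁[ x < M ] (k ≡ᵇ U * oddSquare x)) ∧ (⨁[ y < M ] (m ∸ k ≡ᵇ V * oddSquare y)) ≡⟨ ∧-distribʳ-xorSum _ _ M ⟩
    ⨁[ x < M ] ((k ≡ᵇ U * oddSquare x) ∧ (⨁[ y < M ] (m ∸ k ≡ᵇ V * oddSquare y))) ≡⟨ xorSum-ext M (λ x → ∧-distribˡ-xorSum _ _ M) ⟩
    ⨁[ x < M ] ⨁[ y < M ] c k x y                                             ∎
  collapse : ∀ x y → (⨁[ k < M ] c k x y) ≡ (m ≡ᵇ U * oddSquare x + V * oddSquare y)
  collapse x y = begin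
    ⨁[ k < M ] ((k ≡ᵇ a) ∧ (m ∸ k ≡ᵇ b)) ≡⟨ xorSum-ext M (λ k → ∧-comm (k ≡ᵇ a) _) ⟩
    ⨁[ k < M ] ((m ∸ k ≡ᵇ b) ∧ (k ≡ᵇ a)) ≡⟨ xorSum-select (λ k → m ∸ k ≡ᵇ b) a M outside ⟩
    (m ∸ a ≡ᵇ b)                          ≡⟨ ∸-≡ᵇ m a 0<b ⟩
    (m ≡ᵇ a + b)                          ∎
    where
    a b : ℕ
    a = U * oddSquare x
    b = V * oddSquare y
    0<b : 0 < b
    0<b = ≤-trans (s≤s z≤n) (m≤n*m (oddSquare y) V)
    outside : M ≤ a → (m ∸ a ≡ᵇ b) ≡ false
    outside M≤a = ≢⇒≡ᵇ-false (λ m∸a≡b → <⇒≢ 0<b (trans (sym (m≤n⇒m∸n≡0 (≤-trans (n≤1+n m) M≤a))) m∸a≡b))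

θ-⊛-comm : ∀ U V .{{_ : NonZero U}} .{{_ : NonZero V}} → θ U ⊛ θ V ≐ θ V ⊛ θ U
θ-⊛-comm U V m = begin
  (θ U ⊛ θ V) m                                                   ≡⟨ θ-product U V m ⟩
  ⨁[ x < suc m ] ⨁[ y < suc m ] (m ≡ᵇ U * oddSquare x + V * oddSquare y) ≡⟨ xorSum-swap _ (suc m) (suc m) ⟩
  ⨁[ y < suc m ] ⨁[ x < suc m ] (m ≡ᵇ U * oddSquare x + V * oddSquare y) ≡⟨ xorSum-ext (suc m) (λ y → xorSum-ext (suc m) (λ x →
                                                                        cong (m ≡ᵇ_) (+-comm (U * oddSquare x) (V * oddSquare y)))) ⟩
  ⨁[ y < suc m ] ⨁[ x < suc m ] (m ≡ᵇ V * oddSquare y + U * oddSquare x) ≡⟨ θ-product V U m ⟨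
  (θ V ⊛ θ U) m                                                   ∎
  where open ≡-Reasoning

θ-^4 : ∀ T .{{_ : NonZero T}} → θ T ^ₚ 4 ≐ θ (4 * T)
θ-^4 T n = begin
  (θ T ^ₚ 4) n               ≡⟨ ^4≐dilate² (θ T) n ⟩
  dilate (dilate (θ T)) n    ≡⟨ dilate-cong (θ-dilate T) n ⟩
  dilate (θ (2 * T)) n       ≡⟨ θ-dilate (2 * T) {{m*n≢0 2 T}} n ⟩
  θ (2 * (2 * T)) n          ≡⟨ cong (λ S → θ S n) (sym (*-assoc 2 2 T)) ⟩
  θ (4 * T) n                ∎
  where open ≡-Reasoning

n≢3n+1 : ∀ n → n ≢ 3 * n + 1
n≢3n+1 n = <⇒≢ (≤-trans (s≤s (m≤m+n n _)) (≤-reflexive (+-comm 1 (3 * n))))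

isFixed-σ : ∀ x y → isFixed σ (x , y) ≡ (y ≡ᵇ x) xor (x ≡ᵇ 3 * y + 1)
isFixed-σ x y with x ≟ y | x ≟ 3 * y + 1
... | yes refl | _ rewrite ≡ᵇ-refl x | ≢⇒≡ᵇ-false (n≢3n+1 x) = dec-true (σ (x , x) ≟² (x , x)) (σ-diagonal x)
... | no x≢y | yes refl rewrite ≡ᵇ-refl x | ≢⇒≡ᵇ-false (x≢y ∘ sym) = dec-true (σ (x , y) ≟² (x , y)) (σ-line y)
... | no x≢y | no x≢3y+1 rewrite ≢⇒≡ᵇ-false (x≢y ∘ sym) | ≢⇒≡ᵇ-false x≢3y+1 =
  dec-false (σ (x , y) ≟² (x , y)) λ fixed → [ x≢y , x≢3y+1 ]′ (σ-fixed fixed)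

θT⊛θ3T≐θ4T⊕θ12T : ∀ T .{{_ : NonZero T}} → θ T ⊛ θ (3 * T) ≐ θ (4 * T) ⊕ θ (12 * T)
θT⊛θ3T≐θ4T⊕θ12T T m = begin
  (θ T ⊛ θ (3 * T)) m                                                     ≡⟨ θ-product T (3 * T) m ⟩
  ⨁[ x < M ] ⨁[ y < M ] (m ≡ᵇ T * oddSquare x + 3 * T * oddSquare y)     ≡⟨ xorSum-ext M (λ x → xorSum-ext M (λ y → cong (m ≡ᵇ_) (factor x y))) ⟩
  ⨁[ x < M ] ⨁[ y < M ] c (x , y)                                         ≡⟨ xorSum²-involution M c σ bounded closed σ-involutive ⟩
  ⨁[ x < M ] ⨁[ y < M ] (c (x , y) ∧ isFixed σ (x , y))                   ≡⟨ split-fixed-points ⟩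
  (⨁[ x < M ] ⨁[ y < M ] (c (x , y) ∧ (y ≡ᵇ x))) xor
  (⨁[ x < M ] ⨁[ y < M ] (c (x , y) ∧ (x ≡ᵇ 3 * y + 1)))                  ≡⟨ cong₂ _xor_ diagonal line ⟩
  θ (4 * T) m xor θ (12 * T) m                                            ∎
  where
  open ≡-Reasoning
  M : ℕ
  M = suc m
  instance
    3T≢0 : NonZero (3 * T)
    3T≢0 = m*n≢0 3 T
  c : ℕ × ℕ → Bool
  c p = m ≡ᵇ T * norm p
  factor : ∀ x y → T * oddSquare x + 3 * T * oddSquare y ≡ T * norm (x , y)
  factor x y = distrib T (oddSquare x) (oddSquare y)
    where
    distrib : ∀ T a b → T * a + 3 * T * b ≡ T * (a + 3 * b)
    distrib = solve-∀
  rescale : ∀ k a → T * (k * a) ≡ k * T * a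
  rescale k a = trans (sym (*-assoc T k a)) (cong (_* a) (*-comm T k))
  bounded : ∀ p → c p ≡ true → proj₁ p < M × proj₂ p < M
  bounded (x , y) cp = s≤s (≤-trans (proj₁ (components≤norm x y)) N≤m) , s≤s (≤-trans (proj₂ (components≤norm x y)) N≤m)
    where
    N≤m : norm (x , y) ≤ m
    N≤m = ≤-trans (m≤n*m _ T) (≤-reflexive (sym (≡ᵇ-true⇒≡ cp)))
  closed : ∀ p → c p ≡ true → c (σ p) ≡ true
  closed p cp = trans (cong (λ n → m ≡ᵇ T * n) (norm-σ p)) cp
  outside : ∀ x y → M ≤ x → c (x , y) ≡ false
  outside x y M≤x with c (x , y) in cxy
  ... | false = refl
  ... | true  = ⊥-elim (<⇒≱ (proj₁ (bounded (x , y) cxy)) M≤x)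
  split-fixed-points : (⨁[ x < M ] ⨁[ y < M ] (c (x , y) ∧ isFixed σ (x , y)))
                     ≡ (⨁[ x < M ] ⨁[ y < M ] (c (x , y) ∧ (y ≡ᵇ x))) xor (⨁[ x < M ] ⨁[ y < M ] (c (x , y) ∧ (x ≡ᵇ 3 * y + 1)))
  split-fixed-points = trans (xorSum-ext M (λ x → trans (xorSum-ext M (λ y →
      trans (cong (c (x , y) ∧_) (isFixed-σ x y)) (∧-distribˡ-xor (c (x , y)) _ _))) (xorSum-xor M))) (xorSum-xor M)
  diagonal : (⨁[ x < M ] ⨁[ y < M ] (c (x , y) ∧ (y ≡ᵇ x))) ≡ θ (4 * T) m
  diagonal = xorSum-ext M λ x → trans (xorSum-select (λ y → c (x , y)) x M (outside x x))
                                      (cong (m ≡ᵇ_) (trans (cong (T *_) (norm-diagonal x)) (rescale 4 (oddSquare x))))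
  line : (⨁[ x < M ] ⨁[ y < M ] (c (x , y) ∧ (x ≡ᵇ 3 * y + 1))) ≡ θ (12 * T) m
  line = trans (xorSum-swap _ M M) (xorSum-ext M λ y →
           trans (xorSum-select (λ x → c (x , y)) (3 * y + 1) M (λ M≤ → outside (3 * y + 1) y M≤))
                 (cong (m ≡ᵇ_) (trans (cong (T *_) (norm-line y)) (rescale 12 (oddSquare y)))))

AtMostOne : (ℕ → Bool) → Set
AtMostOne g = ∀ {i j} → g i ≡ true → g j ≡ true → i ≡ j

xorSum-true⇒∃ : ∀ g n → xorSum g n ≡ true → ∃[ i ] i < n × g i ≡ true
xorSum-true⇒∃ g (suc n) sum≡true with g n in gn
... | true  = n , n<1+n n , gn
... | false with xorSum-true⇒∃ g n (trans (sym (xor-identityʳ _)) sum≡true)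
...   | i , i<n , gi = i , m<n⇒m<1+n i<n , gi

xorSum-atMostOne : ∀ g n → AtMostOne g → ∀ {i} → i < n → g i ≡ true → xorSum g n ≡ true
xorSum-atMostOne g n unique {i} i<n gi = trans (xorSum-single g n i i<n others) gi
  where
  others : ∀ k → k < n → k ≢ i → g k ≡ false
  others k _ k≢i with g k in gk
  ... | false = refl
  ... | true  = ⊥-elim (k≢i (unique gk gi))

xorSum-atMostOne-≡ : ∀ g n h n′ → AtMostOne g → AtMostOne h →
  (∀ {i} → i < n → g i ≡ true → ∃[ j ] j < n′ × h j ≡ true) →
  (∀ {j} → j < n′ → h j ≡ true → ∃[ i ] i < n × g i ≡ true) →
  xorSum g n ≡ xorSum h n′
xorSum-atMostOne-≡ g n h n′ g-unique h-unique g⇒h h⇒g with xorSum g n in eq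
... | true with xorSum-true⇒∃ g n eq
...   | i , i<n , gi with g⇒h i<n gi
...     | j , j<n′ , hj = sym (xorSum-atMostOne h n′ h-unique j<n′ hj)
xorSum-atMostOne-≡ g n h n′ g-unique h-unique g⇒h h⇒g | false with xorSum h n′ in eq′
... | false = refl
... | true with xorSum-true⇒∃ h n′ eq′
...   | j , j<n′ , hj with h⇒g j<n′ hj
...     | i , i<n , gi = trans (sym eq) (xorSum-atMostOne g n g-unique i<n gi)

any-upTo : ∀ g n → AtMostOne g → any g (upTo n) ≡ xorSum g n
any-upTo g n unique = trans (cong (foldr _∨_ false) (map-upTo g n)) (or-applyUpTo g n unique)
  where
  or-applyUpTo : ∀ g n → AtMostOne g → foldr _∨_ false (applyUpTo g n) ≡ xorSum g n
  or-applyUpTo g zero    _      = refl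
  or-applyUpTo g (suc n) unique with g 0 in g0
  ... | true  = sym (trans (xorSum-suc g n) (cong₂ _xor_ g0 (xorSum-false _ n (λ k _ → rest-false k))))
    where
    rest-false : ∀ k → g (suc k) ≡ false
    rest-false k with g (suc k) in gk
    ... | false = refl
    ... | true  = case unique gk g0 of λ ()
  ... | false = trans (or-applyUpTo (g ∘ suc) n (λ gi gj → suc-injective (unique gi gj)))
                      (sym (trans (xorSum-suc g n) (cong (_xor xorSum (g ∘ suc) n) g0)))

square-injective : ∀ {m n} → m * m ≡ n * n → m ≡ n
square-injective {m} {n} eq with <-cmp m n
... | tri< m<n _ _ = ⊥-elim (<⇒≢ (*-mono-< m<n m<n) eq)
... | tri≈ _ m≡n _ = m≡n
... | tri> _ _ n<m = ⊥-elim (<⇒≢ (*-mono-< n<m n<m) (sym eq))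

oddSquare-injective : ∀ {x y} → oddSquare x ≡ oddSquare y → x ≡ y
oddSquare-injective {x} {y} eq = *-cancelˡ-≡ x y 2 (suc-injective (square-injective eq))

θ-atMostOne : ∀ T .{{_ : NonZero T}} m → AtMostOne (λ x → m ≡ᵇ T * oddSquare x)
θ-atMostOne T m {x} {y} hx hy =
  oddSquare-injective (*-cancelˡ-≡ _ _ T (trans (sym (≡ᵇ-true⇒≡ {m} hx)) (≡ᵇ-true⇒≡ {m} hy)))

squares-atMostOne : ∀ (p : ℕ → Bool) m → AtMostOne (λ k → p k ∧ (k * k ≡ᵇ m))
squares-atMostOne p m {i} {j} pi pj =
  square-injective (trans (≡ᵇ-true⇒≡ (proj₂ (∧-true pi))) (sym (≡ᵇ-true⇒≡ (proj₂ (∧-true pj)))))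

n≤n*n : ∀ n → n ≤ n * n
n≤n*n zero    = z≤n
n≤n*n (suc n) = m≤m*n (suc n) (suc n)

squares≡θ : ∀ c .{{_ : NonZero c}} (p : ℕ → Bool) →
  (∀ {k} → p k ≡ true → ∃[ x ] k ≡ c * suc (2 * x)) → (∀ x → p (c * suc (2 * x)) ≡ true) →
  ∀ m → (⨁[ k < suc m ] (p k ∧ (k * k ≡ᵇ m))) ≡ θ (c * c) m
squares≡θ c p p⇒form form⇒p m =
  xorSum-atMostOne-≡ _ (suc m) _ (suc m) (squares-atMostOne p m) (θ-atMostOne (c * c) {{c²≢0}} m) square⇒θ θ⇒square
  where
  c²≢0 : NonZero (c * c)
  c²≢0 = m*n≢0 c c
  square : ∀ x → c * suc (2 * x) * (c * suc (2 * x)) ≡ c * c * oddSquare x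
  square x = [ca]²≡c²a² c (suc (2 * x))
    where
    [ca]²≡c²a² : ∀ c a → c * a * (c * a) ≡ c * c * (a * a)
    [ca]²≡c²a² = solve-∀
  square⇒θ : ∀ {k} → k < suc m → p k ∧ (k * k ≡ᵇ m) ≡ true → ∃[ x ] x < suc m × (m ≡ᵇ c * c * oddSquare x) ≡ true
  square⇒θ {k} _ pk∧sq with ∧-true pk∧sq
  ... | pk , sq with p⇒form pk
  ...   | x , refl = x , s≤s (≤-trans (x≤T*oddSquare (c * c) {{c²≢0}} x) (≤-reflexive (sym m≡))) , dec-true (m ≟ _) m≡
    where
    m≡ : m ≡ c * c * oddSquare x
    m≡ = trans (sym (≡ᵇ-true⇒≡ sq)) (square x)
  θ⇒square : ∀ {x} → x < suc m → (m ≡ᵇ c * c * oddSquare x) ≡ true → ∃[ k ] k < suc m × p k ∧ (k * k ≡ᵇ m) ≡ true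
  θ⇒square {x} _ θx = k , s≤s (≤-trans (n≤n*n k) (≤-reflexive kk≡m)) , cong₂ _∧_ (form⇒p x) (dec-true (k * k ≟ m) kk≡m)
    where
    k : ℕ
    k = c * suc (2 * x)
    kk≡m : k * k ≡ m
    kk≡m = trans (square x) (sym (≡ᵇ-true⇒≡ θx))

odd-form : ∀ {k} → (k % 2 ≡ᵇ 1) ≡ true → ∃[ x ] k ≡ 1 * suc (2 * x)
odd-form {k} odd = k / 2 , (begin
  k                       ≡⟨ m≡m%n+[m/n]*n k 2 ⟩
  k % 2 + k / 2 * 2       ≡⟨ cong₂ _+_ (≡ᵇ-true⇒≡ odd) (*-comm (k / 2) 2) ⟩
  suc (2 * (k / 2))       ≡⟨ *-identityˡ _ ⟨
  1 * suc (2 * (k / 2))   ∎)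
  where open ≡-Reasoning

1+2x%2≡1 : ∀ x → suc (2 * x) % 2 ≡ 1
1+2x%2≡1 x = trans (cong (λ n → suc n % 2) (*-comm 2 x)) ([m+kn]%n≡m%n 1 x 2)

odd-squares≡θ1 : ∀ m → (⨁[ k < suc m ] ((k % 2 ≡ᵇ 1) ∧ (k * k ≡ᵇ m))) ≡ θ 1 m
odd-squares≡θ1 = squares≡θ 1 (λ k → k % 2 ≡ᵇ 1) odd-form odd
  where
  odd : ∀ x → (1 * suc (2 * x) % 2 ≡ᵇ 1) ≡ true
  odd x = trans (cong (λ n → n % 2 ≡ᵇ 1) (*-identityˡ (suc (2 * x)))) (cong (_≡ᵇ 1) (1+2x%2≡1 x))

F≐θ1 : F ≐ θ 1
F≐θ1 m = trans (any-upTo _ (suc m) (squares-atMostOne _ m)) (odd-squares≡θ1 m)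

sub3-cong : ∀ {f g} → f ≐ g → sub3 f ≐ sub3 g
sub3-cong f≐g n with n % 3 ≡ᵇ 0
... | true  = f≐g (n / 3)
... | false = refl

3*n/3≡n : ∀ n → 3 * n / 3 ≡ n
3*n/3≡n n = trans (cong (_/ 3) (*-comm 3 n)) (m*n/n≡m n 3)

3*n%3≡0 : ∀ n → 3 * n % 3 ≡ 0
3*n%3≡0 n = trans (cong (_% 3) (*-comm 3 n)) (m*n%n≡0 n 3)

θ-sub3 : ∀ T .{{_ : NonZero T}} → sub3 (θ T) ≐ θ (3 * T)
θ-sub3 T n with n % 3 ≡ᵇ 0 in divisible
... | true = begin
  θ T (n / 3)                                   ≡⟨ θ-extend T (m/n≤m n 3) ⟩
  ⨁[ x < suc n ] (n / 3 ≡ᵇ T * oddSquare x)     ≡⟨ xorSum-ext (suc n) (λ x → /3-≡ᵇ (T * oddSquare x)) ⟩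
  ⨁[ x < suc n ] (n ≡ᵇ 3 * (T * oddSquare x))   ≡⟨ xorSum-ext (suc n) (λ x → cong (n ≡ᵇ_) (*-assoc 3 T (oddSquare x))) ⟨
  θ (3 * T) n                                   ∎
  where
  open ≡-Reasoning
  n≡3*[n/3] : n ≡ 3 * (n / 3)
  n≡3*[n/3] = trans (m≡m%n+[m/n]*n n 3) (trans (cong (_+ n / 3 * 3) (≡ᵇ-true⇒≡ divisible)) (*-comm (n / 3) 3))
  /3-≡ᵇ : ∀ a → (n / 3 ≡ᵇ a) ≡ (n ≡ᵇ 3 * a)
  /3-≡ᵇ a with n / 3 ≟ a
  ... | yes n/3≡a = trans (dec-true (n / 3 ≟ a) n/3≡a) (sym (dec-true (n ≟ 3 * a) (trans n≡3*[n/3] (cong (3 *_) n/3≡a))))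
  ... | no  n/3≢a = trans (dec-false (n / 3 ≟ a) n/3≢a)
                          (sym (dec-false (n ≟ 3 * a) λ n≡3a → n/3≢a (trans (cong (_/ 3) n≡3a) (3*n/3≡n a))))
... | false = sym (xorSum-false _ (suc n) (λ x _ → dec-false (n ≟ 3 * T * oddSquare x) λ n≡ →
  case trans (sym divisible) (cong (_≡ᵇ 0) (trans (cong (_% 3) (trans n≡ (*-assoc 3 T _))) (3*n%3≡0 (T * oddSquare x))))
  of λ ()))

gcd[m%n,n]≡gcd[m,n] : ∀ m n .{{_ : NonZero n}} → gcd (m % n) n ≡ gcd m n
gcd[m%n,n]≡gcd[m,n] m n = GCD.unique (GCD.sym n,m) (gcd-GCD m n)
  where
  d : ℕ
  d = gcd (m % n) n
  add-multiple : ∀ q → GCD n (q * n + m % n) d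
  add-multiple zero    = GCD.sym (gcd-GCD (m % n) n)
  add-multiple (suc q) = subst (λ k → GCD n k d) (sym (+-assoc n (q * n) (m % n))) (GCD.step (add-multiple q))
  n,m : GCD n m d
  n,m = subst (λ k → GCD n k d) (trans (+-comm (m / n * n) (m % n)) (sym (m≡m%n+[m/n]*n m n))) (add-multiple (m / n))

%6-%2 : ∀ k → k % 6 % 2 ≡ k % 2
%6-%2 k = m∣n⇒o%n%m≡o%m 2 6 k (divides 3 refl)

%6-%3 : ∀ k → k % 6 % 3 ≡ k % 3
%6-%3 k = m∣n⇒o%n%m≡o%m 3 6 k (divides 2 refl)

coprime-to-6 : ∀ k → (gcd k 6 ≡ᵇ 1) ≡ (k % 2 ≡ᵇ 1) ∧ not (k % 3 ≡ᵇ 0)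
coprime-to-6 k rewrite sym (gcd[m%n,n]≡gcd[m,n] k 6) | sym (%6-%2 k) | sym (%6-%3 k) = by-residue (k % 6) (m%n<n k 6)
  where
  by-residue : ∀ r → r < 6 → (gcd r 6 ≡ᵇ 1) ≡ (r % 2 ≡ᵇ 1) ∧ not (r % 3 ≡ᵇ 0)
  by-residue 0 _ = refl
  by-residue 1 _ = refl
  by-residue 2 _ = refl
  by-residue 3 _ = refl
  by-residue 4 _ = refl
  by-residue 5 _ = refl
  by-residue (suc (suc (suc (suc (suc (suc _)))))) (s≤s (s≤s (s≤s (s≤s (s≤s (s≤s ()))))))

odd-multiple-of-3-form : ∀ {k} → (k % 2 ≡ᵇ 1) ∧ (k % 3 ≡ᵇ 0) ≡ true → ∃[ x ] k ≡ 3 * suc (2 * x)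
odd-multiple-of-3-form {k} odd∧3∣k = k / 6 , (begin
  k                     ≡⟨ m≡m%n+[m/n]*n k 6 ⟩
  k % 6 + k / 6 * 6     ≡⟨ cong (_+ k / 6 * 6) (residue-3 (k % 6) (m%n<n k 6) odd∧3∣[k%6]) ⟩
  3 + k / 6 * 6         ≡⟨ regroup (k / 6) ⟩
  3 * suc (2 * (k / 6)) ∎)
  where
  open ≡-Reasoning
  odd∧3∣[k%6] : (k % 6 % 2 ≡ᵇ 1) ∧ (k % 6 % 3 ≡ᵇ 0) ≡ true
  odd∧3∣[k%6] = subst₂ (λ a b → (a ≡ᵇ 1) ∧ (b ≡ᵇ 0) ≡ true) (sym (%6-%2 k)) (sym (%6-%3 k)) odd∧3∣k
  residue-3 : ∀ r → r < 6 → (r % 2 ≡ᵇ 1) ∧ (r % 3 ≡ᵇ 0) ≡ true → r ≡ 3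
  residue-3 0 _ ()
  residue-3 1 _ ()
  residue-3 2 _ ()
  residue-3 3 _ _ = refl
  residue-3 4 _ ()
  residue-3 5 _ ()
  residue-3 (suc (suc (suc (suc (suc (suc _)))))) (s≤s (s≤s (s≤s (s≤s (s≤s (s≤s ())))))) _
  regroup : ∀ q → 3 + q * 6 ≡ 3 * suc (2 * q)
  regroup = solve-∀

odd-multiple-of-3 : ∀ x → (3 * suc (2 * x) % 2 ≡ᵇ 1) ∧ (3 * suc (2 * x) % 3 ≡ᵇ 0) ≡ true
odd-multiple-of-3 x = cong₂ _∧_ (cong (_≡ᵇ 1) (trans (cong (_% 2) (regroup x)) ([m+kn]%n≡m%n 1 (suc (3 * x)) 2)))
                                (cong (_≡ᵇ 0) (3*n%3≡0 (suc (2 * x))))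
  where
  regroup : ∀ x → 3 * suc (2 * x) ≡ 1 + suc (3 * x) * 2
  regroup = solve-∀

D≐θ1⊕θ9 : D ≐ θ 1 ⊕ θ 9
D≐θ1⊕θ9 m = begin
  D m                                                                      ≡⟨ any-upTo _ (suc m) (squares-atMostOne _ m) ⟩
  ⨁[ k < suc m ] ((gcd k 6 ≡ᵇ 1) ∧ sq k)                                    ≡⟨ xorSum-ext (suc m) (λ k → cong (_∧ sq k) (coprime-to-6 k)) ⟩
  ⨁[ k < suc m ] ((odd k ∧ not (3∣ k)) ∧ sq k)                              ≡⟨ xorSum-ext (suc m) (λ k → split (odd k) (3∣ k) (sq k)) ⟩
  ⨁[ k < suc m ] ((odd k ∧ sq k) xor ((odd k ∧ 3∣ k) ∧ sq k))               ≡⟨ xorSum-xor (suc m) ⟩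
  (⨁[ k < suc m ] (odd k ∧ sq k)) xor (⨁[ k < suc m ] ((odd k ∧ 3∣ k) ∧ sq k))
      ≡⟨ cong₂ _xor_ (odd-squares≡θ1 m) (squares≡θ 3 _ odd-multiple-of-3-form odd-multiple-of-3 m) ⟩
  θ 1 m xor θ 9 m                                                          ∎
  where
  open ≡-Reasoning
  odd 3∣ sq : ℕ → Bool
  odd k = k % 2 ≡ᵇ 1
  3∣ k  = k % 3 ≡ᵇ 0
  sq k  = k * k ≡ᵇ m
  split : ∀ a b c → (a ∧ not b) ∧ c ≡ (a ∧ c) xor ((a ∧ b) ∧ c)
  split false _     _ = refl
  split true  false c = sym (xor-identityʳ c)
  split true  true  c = sym (xor-same c)

G≐θ3 : G ≐ θ 3
G≐θ3 n = trans (sub3-cong F≐θ1 n) (θ-sub3 1 n)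

F⊛G≐θ4⊕θ12 : F ⊛ G ≐ θ 4 ⊕ θ 12
F⊛G≐θ4⊕θ12 n = trans (⊛-cong F≐θ1 G≐θ3 n) (θT⊛θ3T≐θ4T⊕θ12T 1 n)

D⁴≐θ4⊕θ36 : D ^ₚ 4 ≐ θ 4 ⊕ θ 36
D⁴≐θ4⊕θ36 n = trans (^ₚ-cong D≐θ1⊕θ9 4 n) (trans (^4-⊕ (θ 1) (θ 9) n) (cong₂ _xor_ (θ-^4 1 n) (θ-^4 9 n)))

D⊛G≐θ4⊕θ36 : D ⊛ G ≐ θ 4 ⊕ θ 36
D⊛G≐θ4⊕θ36 n = begin
  (D ⊛ G) n                                    ≡⟨ ⊛-cong D≐θ1⊕θ9 G≐θ3 n ⟩
  ((θ 1 ⊕ θ 9) ⊛ θ 3) n                        ≡⟨ ⊛-distribʳ-⊕ (θ 1) (θ 9) (θ 3) n ⟩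
  (θ 1 ⊛ θ 3) n xor (θ 9 ⊛ θ 3) n              ≡⟨ cong ((θ 1 ⊛ θ 3) n xor_) (θ-⊛-comm 9 3 n) ⟩
  (θ 1 ⊛ θ 3) n xor (θ 3 ⊛ θ 9) n              ≡⟨ cong₂ _xor_ (θT⊛θ3T≐θ4T⊕θ12T 1 n) (θT⊛θ3T≐θ4T⊕θ12T 3 n) ⟩
  (θ 4 n xor θ 12 n) xor (θ 12 n xor θ 36 n)   ≡⟨ xor-assoc (θ 4 n) (θ 12 n) _ ⟩
  θ 4 n xor (θ 12 n xor (θ 12 n xor θ 36 n))   ≡⟨ cong (θ 4 n xor_) (xor-cancelˡ (θ 12 n) (θ 36 n)) ⟩
  θ 4 n xor θ 36 n                             ∎
  where open ≡-Reasoning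

theorem2p9 : (∀ n → (F ^ₚ 4 ⊕ F ⊛ G ⊕ G ^ₚ 4) n ≡ zeroPS n) × (∀ n → (D ^ₚ 3) n ≡ G n)
theorem2p9 = part-a , part-b
  where
  open ≡-Reasoning
  part-a : ∀ n → (F ^ₚ 4 ⊕ F ⊛ G ⊕ G ^ₚ 4) n ≡ zeroPS n
  part-a n = begin
    ((F ^ₚ 4) n xor (F ⊛ G) n) xor (G ^ₚ 4) n  ≡⟨ cong₂ _xor_ (cong₂ _xor_ (trans (^ₚ-cong F≐θ1 4 n) (θ-^4 1 n)) (F⊛G≐θ4⊕θ12 n))
                                                             (trans (^ₚ-cong G≐θ3 4 n) (θ-^4 3 n)) ⟩
    (θ 4 n xor (θ 4 n xor θ 12 n)) xor θ 12 n  ≡⟨ cong (_xor θ 12 n) (xor-cancelˡ (θ 4 n) (θ 12 n)) ⟩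
    θ 12 n xor θ 12 n                          ≡⟨ xor-same (θ 12 n) ⟩
    false                                      ∎
  D⊛[D³⊕G]≐0 : D ⊛ (D ^ₚ 3 ⊕ G) ≐ zeroPS
  D⊛[D³⊕G]≐0 n = begin
    (D ⊛ (D ^ₚ 3 ⊕ G)) n                       ≡⟨ ⊛-distribˡ-⊕ D (D ^ₚ 3) G n ⟩
    (D ^ₚ 4) n xor (D ⊛ G) n                   ≡⟨ cong₂ _xor_ (D⁴≐θ4⊕θ36 n) (D⊛G≐θ4⊕θ36 n) ⟩
    (θ 4 n xor θ 36 n) xor (θ 4 n xor θ 36 n)  ≡⟨ xor-same (θ 4 n xor θ 36 n) ⟩
    false                                      ∎
  part-b : ∀ n → (D ^ₚ 3) n ≡ G n
  part-b n = xor≡false⇒≡ (⊛-cancelˡ D (D ^ₚ 3 ⊕ G) refl refl D⊛[D³⊕G]≐0 n)
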